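{- Let $q\geq 5$ be an integer and let $k,n$ be integers with $k\geq 1$ and $n\geq k+2$. Let $u$ be the natural number with base-$q$ expansion $(u)_q=(q-1)^{(k)}\,0\,(q-1)^{(n)}$. Then $s_q(u^2)=(q-1)(n+1)$ and $s_q(u)=(q-1)(n+k)$.
   Context: $s_q(n)$ denotes the sum of the digits of $n$ in base $q$. In a digit string, $x^{(a)}$ denotes the digit $x$ repeated $a$ times consecutively, read from most to least significant digit; so $(u)_q$ is $k$ digits $q-1$, then a $0$, then $n$ digits $q-1$. -}

module Defs where

open import Data.Nat using (ℕ; zero; suc; _+_; _*_; _∸_; NonZero)
open import Data.Nat.DivMod using (_/_; _%_)
open import Data.List using (List; []; _∷_; _++_; replicate; foldl)

sqAux : ℕ → (q : ℕ) → .{{NonZero q}} → ℕ → ℕ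
sqAux zero    q m = 0
sqAux (suc f) q zero = 0
sqAux (suc f) q m@(suc _) = m % q + sqAux f q (m / q)

-- s_q(m): fuel m suffices for q ≥ 2 (m has at most m base-q digits).
s : (q : ℕ) → .{{NonZero q}} → ℕ → ℕ
s q m = sqAux m q m

fromDigits : ℕ → List ℕ → ℕ
fromDigits q = foldl (λ acc d → acc * q + d) 0

u : ℕ → ℕ → ℕ → ℕ
u q k n = fromDigits q (replicate k (q ∸ 1) ++ (0 ∷ replicate n (q ∸ 1)))

-- Write k = a + 1 and n = a + b + 3.  Then u² has the base-q expansion
--   (q-1)^(k-1) (q-2) 2 0^(k-1) (q-2) 0 (q-1)^(n-k-2) (q-2) 0^(k-1) 1 (q-2) 0^(n-1) 1,
-- whose digits add up to (q-1)(n+1).  To check it, note that both digit strings are runs of a single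
-- digit and a run of j digits q-1 has value q^j - 1; so their values are polynomials in c = q - 2,
-- X = q^a - 1 and Y = q^b - 1, and they agree by a polynomial identity.  As every digit is below q,
-- s_q of the value of either string is the plain sum of its digits.
module Submission where

open import Defs
open import Data.Nat using (ℕ; zero; suc; _+_; _*_; _∸_; _^_; _≤_; _<_; z≤n; s≤s; z<s; s<s; NonZero)
open import Data.Nat.Properties
open import Data.Nat.DivMod using (_/_; _%_; m<n⇒m%n≡m; [m+kn]%n≡m%n; +-distrib-/-∣ʳ; m<n⇒m/n≡0; m*n/n≡m; m*n%n≡0; 0/n≡0)
open import Data.Nat.Divisibility using (n∣m*n)
open import Data.Nat.ListAction using (sum)
open import Data.Nat.ListAction.Properties using (sum-++)
open import Data.Nat.Tactic.RingSolver using (solve-∀)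
open import Data.List using (List; []; _∷_; _++_; _∷ʳ_; replicate; foldl; length; concat; map)
open import Data.List.Properties using (foldl-++; foldl-∷ʳ; length-replicate)
open import Data.List.Reverse using (Reverse; []; _∶_∶ʳ_; reverseView)
open import Data.List.Relation.Unary.All using (All; []; _∷_)
open import Data.List.Relation.Unary.All.Properties using (∷ʳ⁻; ++⁺; concat⁺; replicate⁺)
open import Data.Product using (_×_; _,_)
open import Relation.Binary.PropositionalEquality

[m*n+o]%n≡o : ∀ m {n o} .{{_ : NonZero n}} → o < n → (m * n + o) % n ≡ o
[m*n+o]%n≡o m {n} {o} o<n = begin
  (m * n + o) % n ≡⟨ cong (_% n) (+-comm (m * n) o) ⟩
  (o + m * n) % n ≡⟨ [m+kn]%n≡m%n o m n ⟩
  o % n           ≡⟨ m<n⇒m%n≡m o<n ⟩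
  o               ∎
  where open ≡-Reasoning

[m*n+o]/n≡m : ∀ m {n o} .{{_ : NonZero n}} → o < n → (m * n + o) / n ≡ m
[m*n+o]/n≡m m {n} {o} o<n = begin
  (m * n + o) / n   ≡⟨ cong (_/ n) (+-comm (m * n) o) ⟩
  (o + m * n) / n   ≡⟨ +-distrib-/-∣ʳ o (n∣m*n m) ⟩
  o / n + m * n / n ≡⟨ cong₂ _+_ (m<n⇒m/n≡0 o<n) (m*n/n≡m m n) ⟩
  m                 ∎
  where open ≡-Reasoning

m*n+o≤1+f⇒m≤f : ∀ m {n o f} → 2 ≤ n → m * n + o ≤ suc f → m ≤ f
m*n+o≤1+f⇒m≤f zero    _   _  = z≤n
m*n+o≤1+f⇒m≤f (suc m) {n} {o} {f} n≥2 le = ≤-pred (begin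
  suc (suc m)   ≤⟨ s≤s (s≤s (m≤m*n m 2)) ⟩
  suc m * 2     ≤⟨ *-monoʳ-≤ (suc m) n≥2 ⟩
  suc m * n     ≤⟨ m≤m+n (suc m * n) o ⟩
  suc m * n + o ≤⟨ le ⟩
  suc f         ∎)
  where open ≤-Reasoning

sqAux-zero : ∀ f q .{{_ : NonZero q}} → sqAux f q 0 ≡ 0
sqAux-zero zero    q = refl
sqAux-zero (suc f) q = refl

sqAux-suc : ∀ f q .{{_ : NonZero q}} m → sqAux (suc f) q m ≡ m % q + sqAux f q (m / q)
sqAux-suc f q zero    = sym (cong₂ _+_ (m*n%n≡0 0 q) (trans (cong (sqAux f q) (0/n≡0 q)) (sqAux-zero f q)))
sqAux-suc f q (suc m) = refl

fromDigits-∷ʳ : ∀ q ds d → fromDigits q (ds ∷ʳ d) ≡ fromDigits q ds * q + d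
fromDigits-∷ʳ q ds d = foldl-∷ʳ _ 0 d ds

sum-∷ʳ : ∀ ds d → sum (ds ∷ʳ d) ≡ sum ds + d
sum-∷ʳ ds d = trans (sum-++ ds (d ∷ [])) (cong (sum ds +_) (+-identityʳ d))

sqAux-fromDigits : ∀ {q} .{{_ : NonZero q}} → 2 ≤ q → ∀ {ds} → Reverse ds → All (_< q) ds →
                   ∀ f → fromDigits q ds ≤ f → sqAux f q (fromDigits q ds) ≡ sum ds
sqAux-fromDigits q≥2 [] _ f _ = sqAux-zero f _
sqAux-fromDigits {q} q≥2 (ds ∶ rs ∶ʳ d) digits f
  with ∷ʳ⁻ digits
... | ds<q , d<q rewrite fromDigits-∷ʳ q ds d | sum-∷ʳ ds d = with-fuel f
  where
  open ≡-Reasoning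
  v : ℕ
  v = fromDigits q ds
  with-fuel : ∀ f → v * q + d ≤ f → sqAux f q (v * q + d) ≡ sum ds + d
  with-fuel zero le = cong₂ _+_ (sqAux-fromDigits q≥2 rs ds<q 0 v≤0) (sym d≡0)
    where
    d≡0 : d ≡ 0
    d≡0 = n≤0⇒n≡0 (≤-trans (m≤n+m d (v * q)) le)
    v≤0 : v ≤ 0
    v≤0 = ≤-trans (m≤m*n v q) (≤-trans (m≤m+n (v * q) d) le)
  with-fuel (suc f) le = begin
    sqAux (suc f) q (v * q + d)                   ≡⟨ sqAux-suc f q _ ⟩
    (v * q + d) % q + sqAux f q ((v * q + d) / q) ≡⟨ cong₂ _+_ ([m*n+o]%n≡o v d<q)
                                                               (cong (sqAux f q) ([m*n+o]/n≡m v d<q)) ⟩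
    d + sqAux f q v                               ≡⟨ cong (d +_) (sqAux-fromDigits q≥2 rs ds<q f
                                                                   (m*n+o≤1+f⇒m≤f v q≥2 le)) ⟩
    d + sum ds                                    ≡⟨ +-comm d (sum ds) ⟩
    sum ds + d                                    ∎

s-fromDigits : ∀ q .{{_ : NonZero q}} → 2 ≤ q → ∀ {ds} → All (_< q) ds → s q (fromDigits q ds) ≡ sum ds
s-fromDigits q q≥2 {ds} digits = sqAux-fromDigits q≥2 (reverseView ds) digits (fromDigits q ds) ≤-refl

horner : ℕ → ℕ → List ℕ → ℕ
horner q = foldl (λ acc d → acc * q + d)

horner-acc : ∀ q acc ds → horner q acc ds ≡ acc * q ^ length ds + fromDigits q ds
horner-acc q acc []       = sym (trans (+-identityʳ (acc * 1)) (*-identityʳ acc))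
horner-acc q acc (d ∷ ds) = begin
  horner q (acc * q + d) ds                              ≡⟨ horner-acc q (acc * q + d) ds ⟩
  (acc * q + d) * Q + fromDigits q ds                    ≡⟨ regroup acc q d Q (fromDigits q ds) ⟩
  acc * (q * Q) + (d * Q + fromDigits q ds)              ≡⟨ cong (acc * (q * Q) +_) (horner-acc q d ds) ⟨
  acc * (q * Q) + horner q d ds                          ∎
  where
  open ≡-Reasoning
  Q : ℕ
  Q = q ^ length ds
  regroup : ∀ a q d Q F → (a * q + d) * Q + F ≡ a * (q * Q) + (d * Q + F)
  regroup = solve-∀

horner-replicate : ∀ q acc j d → horner q acc (replicate j d) ≡ acc * q ^ j + fromDigits q (replicate j d)
horner-replicate q acc j d =
  trans (horner-acc q acc (replicate j d))
        (cong (λ l → acc * q ^ l + fromDigits q (replicate j d)) (length-replicate j))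

horner-replicate-++ : ∀ q acc j d es →
                      horner q acc (replicate j d ++ es) ≡ horner q (acc * q ^ j + fromDigits q (replicate j d)) es
horner-replicate-++ q acc j d es =
  trans (foldl-++ _ acc (replicate j d) es) (cong (λ acc′ → horner q acc′ es) (horner-replicate q acc j d))

horner-zeros : ∀ q acc j → horner q acc (replicate j 0) ≡ acc * q ^ j
horner-zeros q acc zero    = sym (*-identityʳ acc)
horner-zeros q acc (suc j) = begin
  horner q (acc * q + 0) (replicate j 0) ≡⟨ horner-zeros q (acc * q + 0) j ⟩
  (acc * q + 0) * q ^ j                  ≡⟨ cong (_* q ^ j) (+-identityʳ (acc * q)) ⟩
  acc * q * q ^ j                        ≡⟨ *-assoc acc q (q ^ j) ⟩
  acc * (q * q ^ j)                      ∎
  where open ≡-Reasoning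

horner-zeros-++ : ∀ q acc j es → horner q acc (replicate j 0 ++ es) ≡ horner q (acc * q ^ j) es
horner-zeros-++ q acc j es =
  trans (foldl-++ _ acc (replicate j 0) es) (cong (λ acc′ → horner q acc′ es) (horner-zeros q acc j))

suc-horner-maxDigits : ∀ p acc j → suc (horner (suc p) acc (replicate j p)) ≡ suc acc * suc p ^ j
suc-horner-maxDigits p acc zero    = sym (*-identityʳ (suc acc))
suc-horner-maxDigits p acc (suc j) = begin
  suc (horner (suc p) (acc * suc p + p) (replicate j p)) ≡⟨ suc-horner-maxDigits p (acc * suc p + p) j ⟩
  suc (acc * suc p + p) * suc p ^ j                     ≡⟨ cong (_* suc p ^ j) (regroup acc p) ⟩
  suc acc * suc p * suc p ^ j                           ≡⟨ *-assoc (suc acc) (suc p) (suc p ^ j) ⟩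
  suc acc * (suc p * suc p ^ j)                         ∎
  where
  open ≡-Reasoning
  regroup : ∀ a p → suc (a * suc p + p) ≡ suc a * suc p
  regroup = solve-∀

suc-fromDigits-maxDigits : ∀ p j → suc (fromDigits (suc p) (replicate j p)) ≡ suc p ^ j
suc-fromDigits-maxDigits p j = trans (suc-horner-maxDigits p 0 j) (+-identityʳ (suc p ^ j))

replicate-++ : ∀ m n (x : ℕ) → replicate (m + n) x ≡ replicate m x ++ replicate n x
replicate-++ zero    n x = refl
replicate-++ (suc m) n x = cong (x ∷_) (replicate-++ m n x)

sum-replicate : ∀ j d → sum (replicate j d) ≡ j * d
sum-replicate zero    d = refl
sum-replicate (suc j) d = cong (d +_) (sum-replicate j d)

sum-concat : ∀ xss → sum (concat xss) ≡ sum (map sum xss)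
sum-concat []         = refl
sum-concat (xs ∷ xss) = trans (sum-++ xs (concat xss)) (cong (sum xs +_) (sum-concat xss))

-- The values of (u)_q and of the expansion of u² as computed digit by digit, in terms of c = q - 2,
-- A = q^a, B = q^b and the values X, Y of the runs (q-1)^(a), (q-1)^(b).
uHorner : ℕ → ℕ → ℕ → ℕ → ℕ → ℕ
uHorner c A X B Y =
  let q = 2 + c ; p = 1 + c in
  ((((((p * A + X) * q + 0) * q + p) * q + p) * q + p) * A + X) * B + Y

squareHorner : ℕ → ℕ → ℕ → ℕ → ℕ → ℕ
squareHorner c A X B Y =
  let q = 2 + c in
  ((((((((((X * q + c) * q + 2) * A * q + c) * q + 0) * B + Y) * q + c) * A * q + 1) * q + c) * q + 0) * q + 0) * (A * B) * q + 1

uHorner-square : ∀ c {A X B Y} → A ≡ suc X → B ≡ suc Y →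
                 uHorner c A X B Y * uHorner c A X B Y ≡ squareHorner c A X B Y
uHorner-square c {X = X} {Y = Y} refl refl = expanded c X Y
  where
  -- solve-∀ does not unfold definitions, so uHorner and squareHorner are restated expanded.
  expanded : ∀ c X Y →
    let q = 2 + c ; p = 1 + c ; A = 1 + X ; B = 1 + Y
        U = ((((((p * A + X) * q + 0) * q + p) * q + p) * q + p) * A + X) * B + Y
    in U * U ≡
       ((((((((((X * q + c) * q + 2) * A * q + c) * q + 0) * B + Y) * q + c) * A * q + 1) * q + c) * q + 0) * q + 0) * (A * B) * q + 1
  expanded = solve-∀

-- The runs of the expansion of u², for k = a + 1 and n = a + b + 3.
squareBlocks : ℕ → ℕ → ℕ → List (List ℕ)
squareBlocks q a b =
  replicate a (q ∸ 1) ∷ (q ∸ 2 ∷ 2 ∷ []) ∷ replicate a 0 ∷ (q ∸ 2 ∷ 0 ∷ []) ∷ replicate b (q ∸ 1) ∷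
  (q ∸ 2 ∷ []) ∷ replicate a 0 ∷ (1 ∷ q ∸ 2 ∷ []) ∷ (0 ∷ 0 ∷ []) ∷ replicate (a + b) 0 ∷ (1 ∷ []) ∷ []

module _ (c a b : ℕ) where
  private
    q p n X Y : ℕ
    q = 2 + c
    p = 1 + c
    n = 3 + (a + b)
    X = fromDigits q (replicate a p)
    Y = fromDigits q (replicate b p)

  u-value : u q (suc a) n ≡ uHorner c (q ^ a) X (q ^ b) Y
  u-value =
    trans (cong (λ ds → horner q p (replicate a p ++ 0 ∷ p ∷ p ∷ p ∷ ds)) (replicate-++ a b p))
    (trans (horner-replicate-++ q p a p _)
    (trans (horner-replicate-++ q _ a p _)
           (horner-replicate q _ b p)))

  square-value : fromDigits q (concat (squareBlocks q a b)) ≡ squareHorner c (q ^ a) X (q ^ b) Y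
  square-value rewrite sym (^-distribˡ-+-* q a b) =
    trans (horner-replicate-++ q 0 a p _)
    (trans (horner-zeros-++ q _ a _)
    (trans (horner-replicate-++ q _ b p _)
    (trans (horner-zeros-++ q _ a _)
           (horner-zeros-++ q _ (a + b) _))))

  u-squared : u q (suc a) n * u q (suc a) n ≡ fromDigits q (concat (squareBlocks q a b))
  u-squared = begin
    u q (suc a) n * u q (suc a) n                                 ≡⟨ cong (λ v → v * v) u-value ⟩
    uHorner c (q ^ a) X (q ^ b) Y * uHorner c (q ^ a) X (q ^ b) Y ≡⟨ uHorner-square c q^a≡1+X q^b≡1+Y ⟩
    squareHorner c (q ^ a) X (q ^ b) Y                            ≡⟨ square-value ⟨
    fromDigits q (concat (squareBlocks q a b))                    ∎
    where
    open ≡-Reasoning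
    q^a≡1+X : q ^ a ≡ suc X
    q^a≡1+X = sym (suc-fromDigits-maxDigits p a)
    q^b≡1+Y : q ^ b ≡ suc Y
    q^b≡1+Y = sym (suc-fromDigits-maxDigits p b)

  sum-u : sum (replicate (suc a) p ++ 0 ∷ replicate n p) ≡ p * (n + suc a)
  sum-u = begin
    sum (replicate (suc a) p ++ 0 ∷ replicate n p)        ≡⟨ sum-++ (replicate (suc a) p) (0 ∷ replicate n p) ⟩
    sum (replicate (suc a) p) + sum (replicate n p)       ≡⟨ cong₂ _+_ (sum-replicate (suc a) p) (sum-replicate n p) ⟩
    suc a * p + n * p                                     ≡⟨ *-distribʳ-+ p (suc a) n ⟨
    (suc a + n) * p                                       ≡⟨ *-comm (suc a + n) p ⟩
    p * (suc a + n)                                       ≡⟨ cong (p *_) (+-comm (suc a) n) ⟩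
    p * (n + suc a)                                       ∎
    where open ≡-Reasoning

  sum-square : sum (concat (squareBlocks q a b)) ≡ p * (n + 1)
  sum-square rewrite sum-concat (squareBlocks q a b)
                   | sum-replicate a p | sum-replicate a 0 | sum-replicate b p | sum-replicate (a + b) 0 = regroup a b c
    where
    regroup : ∀ a b c → let p = 1 + c in
      a * p + (c + 2 + (a * 0 + (c + 0 + (b * p + (c + 0 + (a * 0 + (1 + (c + 0) + (0 + 0 + ((a + b) * 0 + 1)))))))))
        ≡ p * (3 + (a + b) + 1)
    regroup = solve-∀

  u-digits<q : All (_< q) (replicate (suc a) p ++ 0 ∷ replicate n p)
  u-digits<q = ++⁺ (replicate⁺ (suc a) (n<1+n p)) (z<s ∷ replicate⁺ n (n<1+n p))

  square-digits<q : 1 ≤ c → All (_< q) (concat (squareBlocks q a b))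
  square-digits<q c≥1 = concat⁺
    (replicate⁺ a p<q ∷ (c<q ∷ 2<q ∷ []) ∷ replicate⁺ a 0<q ∷ (c<q ∷ 0<q ∷ []) ∷ replicate⁺ b p<q ∷
     (c<q ∷ []) ∷ replicate⁺ a 0<q ∷ (1<q ∷ c<q ∷ []) ∷ (0<q ∷ 0<q ∷ []) ∷ replicate⁺ (a + b) 0<q ∷ (1<q ∷ []) ∷ [])
    where
    p<q : p < q
    p<q = n<1+n p
    c<q : c < q
    c<q = m<n⇒m<1+n (n<1+n c)
    0<q : 0 < q
    0<q = z<s
    1<q : 1 < q
    1<q = s<s z<s
    2<q : 2 < q
    2<q = s<s (s<s c≥1)

  digitSum-u : s q (u q (suc a) n) ≡ p * (n + suc a)
  digitSum-u = trans (s-fromDigits q (s≤s (s≤s z≤n)) u-digits<q) sum-u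

  digitSum-u² : 1 ≤ c → s q (u q (suc a) n * u q (suc a) n) ≡ p * (n + 1)
  digitSum-u² c≥1 = begin
    s q (u q (suc a) n * u q (suc a) n)              ≡⟨ cong (s q) u-squared ⟩
    s q (fromDigits q (concat (squareBlocks q a b))) ≡⟨ s-fromDigits q (s≤s (s≤s z≤n)) (square-digits<q c≥1) ⟩
    sum (concat (squareBlocks q a b))                ≡⟨ sum-square ⟩
    p * (n + 1)                                      ∎
    where open ≡-Reasoning

lemma3p4 : (q k n : ℕ) → .{{_ : NonZero q}} → 5 ≤ q → 1 ≤ k → k + 2 ≤ n →
    (s q (u q k n * u q k n) ≡ (q ∸ 1) * (n + 1)) × (s q (u q k n) ≡ (q ∸ 1) * (n + k))
lemma3p4 (suc (suc c)) (suc a) n (s≤s (s≤s c≥3)) (s≤s z≤n) k+2≤n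
  with b , k+2+b≡n ← m≤n⇒∃[o]m+o≡n k+2≤n
  with refl ← trans (sym k+2+b≡n) (cong (λ m → suc (m + b)) (+-comm a 2))
  = digitSum-u² c a b (≤-trans (s≤s z≤n) c≥3) , digitSum-u c a b
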